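{- Let $k\ge4$ be an integer. Every $k$-chordal graph satisfies the $(\lfloor k/4\rfloor,\lfloor k/2\rfloor)$-bow metric.
   Context: Graphs are finite, simple, unweighted, undirected, connected, with shortest-path distance $d$. A graph is $k$-chordal if every induced cycle has length at most $k$. The interval is $I(u,v)=\{z: d(u,z)+d(z,v)=d(u,v)\}$. A graph satisfies the $(\lambda,\mu)$-bow metric if for all vertices $u,v,w,x$ with $v\in I(u,w)$, $w\in I(v,x)$ and $d(v,w)>\lambda$, one has $d(u,x)\ge d(u,v)+d(v,w)+d(w,x)-\mu$. -}

module Defs where

open import Data.Nat using (ℕ; zero; suc; _+_; _∸_; _≤_; _<_)
open import Data.Fin using (Fin; toℕ)
open import Data.Bool using (Bool; true; false)
open import Data.Product using (_×_; ∃; Σ)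
open import Data.Sum using (_⊎_)
open import Function.Definitions using (Injective)
open import Relation.Binary.PropositionalEquality using (_≡_)
open import Function.Bundles using (_⇔_)

record Graph (n : ℕ) : Set where
  field
    adj    : Fin n → Fin n → Bool
    sym    : ∀ u v → adj u v ≡ adj v u
    irrefl : ∀ u → adj u u ≡ false

open Graph public

Adj : ∀ {n} → Graph n → Fin n → Fin n → Set
Adj G u v = adj G u v ≡ true

data Walk {n : ℕ} (G : Graph n) : Fin n → Fin n → ℕ → Set where
  nil  : ∀ u → Walk G u u zero
  cons : ∀ {u w v ℓ} → Adj G u w → Walk G w v ℓ → Walk G u v (suc ℓ)

Connected : ∀ {n} → Graph n → Set
Connected G = ∀ u v → ∃ λ ℓ → Walk G u v ℓ

Dist : ∀ {n} → Graph n → Fin n → Fin n → ℕ → Set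
Dist G u v m = Walk G u v m × (∀ ℓ → Walk G u v ℓ → m ≤ ℓ)

CycAdj : (m : ℕ) → Fin m → Fin m → Set
CycAdj m i j =
    toℕ j ≡ suc (toℕ i) ⊎ toℕ i ≡ suc (toℕ j)
  ⊎ (toℕ i ≡ m ∸ 1 × toℕ j ≡ 0) ⊎ (toℕ j ≡ m ∸ 1 × toℕ i ≡ 0)

IsInducedCycle : ∀ {n} → Graph n → (m : ℕ) → (Fin m → Fin n) → Set
IsInducedCycle G m c =
  3 ≤ m × Injective _≡_ _≡_ c × (∀ i j → Adj G (c i) (c j) ⇔ CycAdj m i j)

KChordal : ∀ {n} → Graph n → ℕ → Set
KChordal G k = ∀ m (c : Fin m → Fin _) → IsInducedCycle G m c → m ≤ k

-- Distances are given relationally: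
-- v ∈ I(u,w) is d(u,v)+d(v,w) = d(u,w), w ∈ I(v,x) is d(v,w)+d(w,x) = d(v,x),
-- and the conclusion d(u,x) ≥ d(u,v)+d(v,w)+d(w,x) − μ is stated as
-- d(u,v)+d(v,w)+d(w,x) ≤ d(u,x) + μ (equivalent over ℕ / ℤ).
BowMetric : ∀ {n} → Graph n → ℕ → ℕ → Set
BowMetric G λ' μ =
  ∀ u v w x (duv dvw dwx duw dvx dux : ℕ) →
  Dist G u v duv → Dist G v w dvw → Dist G w x dwx →
  Dist G u w duw → Dist G v x dvx → Dist G u x dux →
  duv + dvw ≡ duw → dvw + dwx ≡ dvx → λ' < dvw →
  duv + dvw + dwx ≤ dux + μ

module Submission where

-- Induction on d(u,x). Let u, v, w, x be a bow (v ∈ I(u,w), w ∈ I(v,x), m = d(v,w)) that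
-- violates d(u,v) + m + d(w,x) ≤ d(u,x) + μ while every bow with smaller d(u,x) satisfies it.
-- Then u is the only vertex of I(u,x) ∩ I(u,v), since another one, y, would give the smaller
-- violated bow y, v, w, x; symmetrically at x. Let P be a geodesic u–v followed by geodesics
-- v–w and w–x (so P is geodesic from u to w and from v to x) and Q a geodesic from u to x.
-- The part of P between v and w stays at distance at least 2 from Q because μ ≥ 2, and near u
-- the two geodesics can only be joined by rungs Q(σ) – P(σ) or by Q(1) – u; likewise near x.
-- Running along P between the last rungs at both ends and back along Q gives an induced cycle
-- of length greater than μ + 2m ≥ k, contradicting k-chordality. With μ = ⌊k/2⌋ ≥ 2, any
-- m > ⌊k/4⌋ indeed satisfies m ≥ 2 and k ≤ μ + 2m.

open import Defs hiding (sym)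
open import Data.Nat using (ℕ; zero; suc; pred; _+_; _*_; _∸_; _/_; _%_; _≤_; _<_; z≤n; s≤s; _≤?_; _<?_; >-nonZero)
open import Data.Nat.Properties
open import Data.Nat.DivMod using (m≡m%n+[m/n]*n; m%n<n; /-mono-≤)
open import Data.Nat.Induction using (<-rec)
open import Data.Nat.Tactic.RingSolver using (solve)
open import Data.Fin using (Fin; toℕ) renaming (_≟_ to _≟ᶠ_)
open import Data.Fin.Properties using (any?; toℕ-injective; toℕ<n)
open import Data.Bool using (true)
open import Data.Bool.Properties using () renaming (_≟_ to _≟ᵇ_)
open import Data.List using (_∷_; [])
open import Data.Product using (_×_; ∃; _,_; proj₁; proj₂)
open import Data.Sum using (_⊎_; inj₁; inj₂)
open import Data.Empty using (⊥; ⊥-elim)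
open import Function using (_∘_)
open import Function.Bundles using (mk⇔)
open import Relation.Nullary using (Dec; yes; no; ¬_)
open import Relation.Nullary.Decidable using (_×-dec_)
open import Relation.Unary using (_∈_)
open import Relation.Binary.Definitions using (tri<; tri≈; tri>)
open import Relation.Binary.PropositionalEquality

m+m≤n+n⇒m≤n : ∀ {m n} → m + m ≤ n + n → m ≤ n
m+m≤n+n⇒m≤n m+m≤n+n = ≮⇒≥ λ n<m → <⇒≱ (+-mono-< n<m n<m) m+m≤n+n

-- Linear inequalities over ℕ are proved by adding up hypotheses into A ≤ B
-- and checking the identity P + B ≡ Q + A with the ring solver.
linear-combination : ∀ {P Q A B} → A ≤ B → P + B ≡ Q + A → P ≤ Q
linear-combination {P} {Q} {A} {B} A≤B eq =
  +-cancelʳ-≤ B P Q (≤-trans (≤-reflexive eq) (+-monoʳ-≤ Q A≤B))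

infixr 5 _⊕_
_⊕_ : ∀ {a b c d} → a ≤ b → c ≤ d → a + c ≤ b + d
_⊕_ = +-mono-≤

splice : {A : Set} → ℕ → (ℕ → A) → (ℕ → A) → ℕ → A
splice zero    f g i       = g i
splice (suc N) f g zero    = f zero
splice (suc N) f g (suc i) = splice N (f ∘ suc) g i

module _ {A : Set} where

  splice-< : ∀ N (f g : ℕ → A) {i} → i < N → splice N f g i ≡ f i
  splice-< (suc N) f g {zero}  _         = refl
  splice-< (suc N) f g {suc i} (s≤s i<N) = splice-< N (f ∘ suc) g i<N

  splice-+ : ∀ N (f g : ℕ → A) r → splice N f g (N + r) ≡ g r
  splice-+ zero    f g r = refl
  splice-+ (suc N) f g r = splice-+ N (f ∘ suc) g r

  splice-zero : ∀ N (f g : ℕ → A) → f N ≡ g 0 → splice N f g 0 ≡ f 0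
  splice-zero zero    f g f₀≡g₀ = sym f₀≡g₀
  splice-zero (suc N) f g _     = refl

private
  ¬-up-to-suc : ∀ {P : ℕ → Set} {K i} → (i ≤ K → ¬ P i) → ¬ P (suc K) → i ≤ suc K → ¬ P i
  ¬-up-to-suc ¬P ¬P[1+K] i≤1+K with m≤n⇒m<n∨m≡n i≤1+K
  ... | inj₁ i<1+K = ¬P (≤-pred i<1+K)
  ... | inj₂ refl  = ¬P[1+K]

last-satisfying : ∀ {P : ℕ → Set} → (∀ i → Dec (P i)) → ∀ K →
  (∀ i → 1 ≤ i → i ≤ K → ¬ P i) ⊎
  ∃ λ l → 1 ≤ l × l ≤ K × P l × (∀ i → l < i → i ≤ K → ¬ P i)
last-satisfying P? zero = inj₁ λ { (suc _) _ () }
last-satisfying {P} P? (suc K) with P? (suc K)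
... | yes P[1+K] = inj₂ (suc K , s≤s z≤n , ≤-refl , P[1+K] , λ i 1+K<i i≤1+K _ → <⇒≱ 1+K<i i≤1+K)
... | no ¬P[1+K] with last-satisfying P? K
...   | inj₁ none = inj₁ λ i 1≤i → ¬-up-to-suc {P} (none i 1≤i) ¬P[1+K]
...   | inj₂ (l , 1≤l , l≤K , Pₗ , after) =
  inj₂ (l , 1≤l , m≤n⇒m≤1+n l≤K , Pₗ , λ i l<i → ¬-up-to-suc {P} (after i l<i) ¬P[1+K])

module GraphBasics {n : ℕ} (G : Graph n) where

  Vertex : Set
  Vertex = Fin n

  Adj-sym : ∀ {u v} → Adj G u v → Adj G v u
  Adj-sym {u} {v} = trans (Graph.sym G v u)

  Adj⇒≢ : ∀ {u v} → Adj G u v → u ≢ v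
  Adj⇒≢ {u} e refl with trans (sym e) (irrefl G u)
  ... | ()

  Adj? : ∀ u v → Dec (Adj G u v)
  Adj? u v = adj G u v ≟ᵇ true

  _++ʷ_ : ∀ {u v w a b} → Walk G u v a → Walk G v w b → Walk G u w (a + b)
  nil _    ++ʷ W = W
  cons e V ++ʷ W = cons e (V ++ʷ W)

  reverseʷ : ∀ {u v a} → Walk G u v a → Walk G v u a
  reverseʷ (nil u) = nil u
  reverseʷ (cons {ℓ = ℓ} e W) =
    subst (Walk G _ _) (+-comm ℓ 1) (reverseʷ W ++ʷ cons (Adj-sym e) (nil _))

  Walk? : ∀ ℓ u v → Dec (Walk G u v ℓ)
  Walk? zero u v with u ≟ᶠ v
  ... | yes refl = yes (nil u)
  ... | no u≢v   = no λ { (nil _) → u≢v refl }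
  Walk? (suc ℓ) u v with any? (λ w → Adj? u w ×-dec Walk? ℓ w v)
  ... | yes (w , e , W) = yes (cons e W)
  ... | no ∄w           = no λ { (cons {w = w} e W) → ∄w (w , e , W) }

  shortest : ∀ u v i → (∀ ℓ → ℓ < i → ¬ Walk G u v ℓ) →
             ∀ k → Walk G u v (i + k) → ∃ (Dist G u v)
  shortest u v i shorter k W with Walk? i u v
  ... | yes Wᵢ = i , Wᵢ , λ ℓ Wₗ → ≮⇒≥ λ ℓ<i → shorter ℓ ℓ<i Wₗ
  shortest u v i shorter zero W | no ¬Wᵢ =
    ⊥-elim (¬Wᵢ (subst (Walk G u v) (+-identityʳ i) W))
  shortest u v i shorter (suc k) W | no ¬Wᵢ =
    shortest u v (suc i) shorter′ k (subst (Walk G u v) (+-suc i k) W)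
    where
    shorter′ : ∀ ℓ → ℓ < suc i → ¬ Walk G u v ℓ
    shorter′ ℓ ℓ<1+i with m≤n⇒m<n∨m≡n (≤-pred ℓ<1+i)
    ... | inj₁ ℓ<i = shorter ℓ ℓ<i
    ... | inj₂ refl = ¬Wᵢ

  -- Paths are vertex sequences ℕ → Vertex, of which only the indices 0 … ℓ matter.
  Steps : (ℕ → Vertex) → ℕ → Set
  Steps p ℓ = ∀ i → i < ℓ → Adj G (p i) (p (suc i))

  vertexAt : ∀ {y z ℓ} → Walk G y z ℓ → ℕ → Vertex
  vertexAt {y} (nil _)    i       = y
  vertexAt {y} (cons e W) zero    = y
  vertexAt     (cons e W) (suc i) = vertexAt W i

  vertexAt-start : ∀ {y z ℓ} (W : Walk G y z ℓ) → vertexAt W 0 ≡ y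
  vertexAt-start (nil _)    = refl
  vertexAt-start (cons e W) = refl

  vertexAt-end : ∀ {y z ℓ} (W : Walk G y z ℓ) → vertexAt W ℓ ≡ z
  vertexAt-end (nil _)    = refl
  vertexAt-end (cons e W) = vertexAt-end W

  vertexAt-steps : ∀ {y z ℓ} (W : Walk G y z ℓ) → Steps (vertexAt W) ℓ
  vertexAt-steps (cons e W) zero    _         = subst (Adj G _) (sym (vertexAt-start W)) e
  vertexAt-steps (cons e W) (suc i) (s≤s i<ℓ) = vertexAt-steps W i i<ℓ

  splice-steps : ∀ {A B f g} → Steps f A → Steps g B → f A ≡ g 0 → Steps (splice A f g) (A + B)
  splice-steps {zero}          _  g-steps _    = g-steps
  splice-steps {suc A} {f = f} {g} f-steps _ join zero _ =
    subst (Adj G (f 0)) (sym (splice-zero A (f ∘ suc) g join)) (f-steps 0 (s≤s z≤n))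
  splice-steps {suc A} f-steps g-steps join (suc i) (s≤s i<A+B) =
    splice-steps (λ j j<A → f-steps (suc j) (s≤s j<A)) g-steps join i i<A+B

  Steps-slice : ∀ {p ℓ} c {ℓ′} → Steps p ℓ → c + ℓ′ ≤ ℓ → Steps (λ i → p (c + i)) ℓ′
  Steps-slice {p} c steps c+ℓ′≤ℓ i i<ℓ′ = subst (λ k → Adj G (p (c + i)) (p k)) (sym (+-suc c i))
    (steps (c + i) (≤-trans (≤-reflexive (sym (+-suc c i))) (≤-trans (+-monoʳ-≤ c i<ℓ′) c+ℓ′≤ℓ)))

  isInducedCycle : (c : ℕ → Vertex) (L : ℕ) → 3 ≤ L →
    (∀ i → suc i < L → Adj G (c i) (c (suc i))) →
    Adj G (c (L ∸ 1)) (c 0) →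
    (∀ i j → i < j → j < L → Adj G (c i) (c j) → suc i ≡ j ⊎ (i ≡ 0 × suc j ≡ L)) →
    (∀ i j → i < j → j < L → c i ≢ c j) →
    IsInducedCycle G L (c ∘ toℕ)
  isInducedCycle c L 3≤L steps closing chords distinct = 3≤L , injective , λ i j → mk⇔ (to i j) (from i j)
    where
    last : ∀ {j} → suc j ≡ L → j ≡ L ∸ 1
    last refl = refl

    injective : ∀ {i j : Fin L} → c (toℕ i) ≡ c (toℕ j) → i ≡ j
    injective {i} {j} cᵢ≡cⱼ with <-cmp (toℕ i) (toℕ j)
    ... | tri< i<j _ _ = ⊥-elim (distinct _ _ i<j (toℕ<n j) cᵢ≡cⱼ)
    ... | tri≈ _ i≡j _ = toℕ-injective i≡j
    ... | tri> _ _ j<i = ⊥-elim (distinct _ _ j<i (toℕ<n i) (sym cᵢ≡cⱼ))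

    to : ∀ (i j : Fin L) → Adj G (c (toℕ i)) (c (toℕ j)) → CycAdj L i j
    to i j e with <-cmp (toℕ i) (toℕ j)
    ... | tri≈ _ i≡j _ = ⊥-elim (Adj⇒≢ e (cong c i≡j))
    ... | tri< i<j _ _ with chords _ _ i<j (toℕ<n j) e
    ...   | inj₁ 1+i≡j         = inj₁ (sym 1+i≡j)
    ...   | inj₂ (i≡0 , 1+j≡L) = inj₂ (inj₂ (inj₂ (last 1+j≡L , i≡0)))
    to i j e | tri> _ _ j<i with chords _ _ j<i (toℕ<n i) (Adj-sym e)
    ...   | inj₁ 1+j≡i         = inj₂ (inj₁ (sym 1+j≡i))
    ...   | inj₂ (j≡0 , 1+i≡L) = inj₂ (inj₂ (inj₁ (last 1+i≡L , j≡0)))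

    from : ∀ (i j : Fin L) → CycAdj L i j → Adj G (c (toℕ i)) (c (toℕ j))
    from i j (inj₁ j≡1+i) =
      subst (Adj G (c (toℕ i)) ∘ c) (sym j≡1+i) (steps (toℕ i) (subst (_< L) j≡1+i (toℕ<n j)))
    from i j (inj₂ (inj₁ i≡1+j)) =
      Adj-sym (subst (Adj G (c (toℕ j)) ∘ c) (sym i≡1+j) (steps (toℕ j) (subst (_< L) i≡1+j (toℕ<n i))))
    from i j (inj₂ (inj₂ (inj₁ (i≡L-1 , j≡0)))) =
      subst₂ (λ k k′ → Adj G (c k) (c k′)) (sym i≡L-1) (sym j≡0) closing
    from i j (inj₂ (inj₂ (inj₂ (j≡L-1 , i≡0)))) =
      Adj-sym (subst₂ (λ k k′ → Adj G (c k) (c k′)) (sym j≡L-1) (sym i≡0) closing)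

module Distance {n : ℕ} {G : Graph n} (conn : Connected G) where
  open GraphBasics G

  shortest-walk : ∀ u v → ∃ (Dist G u v)
  shortest-walk u v = shortest u v 0 (λ _ ()) (proj₁ (conn u v)) (proj₂ (conn u v))

  abstract
    dist : Vertex → Vertex → ℕ
    dist u v = proj₁ (shortest-walk u v)

    dist-walk : ∀ u v → Walk G u v (dist u v)
    dist-walk u v = proj₁ (proj₂ (shortest-walk u v))

    dist-minimal : ∀ {u v ℓ} → Walk G u v ℓ → dist u v ≤ ℓ
    dist-minimal {u} {v} {ℓ} = proj₂ (proj₂ (shortest-walk u v)) ℓ

  Dist⇒≡dist : ∀ {u v d} → Dist G u v d → d ≡ dist u v
  Dist⇒≡dist (W , minimal) = ≤-antisym (minimal _ (dist-walk _ _)) (dist-minimal W)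

  dist-triangle : ∀ u v w → dist u w ≤ dist u v + dist v w
  dist-triangle u v w = dist-minimal (dist-walk u v ++ʷ dist-walk v w)

  dist-sym : ∀ u v → dist u v ≡ dist v u
  dist-sym u v = ≤-antisym (dist-minimal (reverseʷ (dist-walk v u)))
                           (dist-minimal (reverseʷ (dist-walk u v)))

  dist-refl : ∀ u → dist u u ≡ 0
  dist-refl u = n≤0⇒n≡0 (dist-minimal (nil u))

  Adj⇒dist≤1 : ∀ {u v} → Adj G u v → dist u v ≤ 1
  Adj⇒dist≤1 e = dist-minimal (cons e (nil _))

  dist≤1⇒≡⊎Adj : ∀ {u v} → dist u v ≤ 1 → u ≡ v ⊎ Adj G u v
  dist≤1⇒≡⊎Adj {u} {v} d≤1 with dist u v | dist-walk u v
  ... | zero  | nil _          = inj₁ refl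
  ... | suc _ | cons e (nil _) = inj₂ e
  dist≤1⇒≡⊎Adj (s≤s ()) | suc (suc _) | _

  dist≡0⇒≡ : ∀ {u v} → dist u v ≡ 0 → u ≡ v
  dist≡0⇒≡ {u} {v} d≡0 with dist u v | dist-walk u v
  ... | zero | nil _ = refl

  ≢⇒1≤dist : ∀ {u v} → u ≢ v → 1 ≤ dist u v
  ≢⇒1≤dist {u} {v} u≢v with dist u v in d≡
  ... | zero  = ⊥-elim (u≢v (dist≡0⇒≡ d≡))
  ... | suc _ = s≤s z≤n

  dist≤1∧≢⇒Adj : ∀ {u v} → dist u v ≤ 1 → u ≢ v → Adj G u v
  dist≤1∧≢⇒Adj d≤1 u≢v with dist≤1⇒≡⊎Adj d≤1
  ... | inj₁ u≡v = ⊥-elim (u≢v u≡v)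
  ... | inj₂ e   = e

  I⟨_,_⟩ : Vertex → Vertex → Vertex → Set
  I⟨ u , v ⟩ z = dist u z + dist z v ≡ dist u v

  ≤⇒∈I : ∀ {u v z} → dist u z + dist z v ≤ dist u v → z ∈ I⟨ u , v ⟩
  ≤⇒∈I {u} {v} {z} h = ≤-antisym h (dist-triangle u z v)

  ∈I-sym : ∀ {u v z} → z ∈ I⟨ u , v ⟩ → z ∈ I⟨ v , u ⟩
  ∈I-sym {u} {v} {z} z∈I = begin
    dist v z + dist z u ≡⟨ cong₂ _+_ (dist-sym v z) (dist-sym z u) ⟩
    dist z v + dist u z ≡⟨ +-comm (dist z v) (dist u z) ⟩
    dist u z + dist z v ≡⟨ z∈I ⟩
    dist u v            ≡⟨ dist-sym u v ⟩
    dist v u            ∎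
    where open ≡-Reasoning

  ∈I-shrinkˡ : ∀ {u v w y} → y ∈ I⟨ u , v ⟩ → v ∈ I⟨ u , w ⟩ → v ∈ I⟨ y , w ⟩
  ∈I-shrinkˡ {u} {v} {w} {y} y∈I v∈I = ≤⇒∈I (+-cancelˡ-≤ (dist u y) _ _ (begin
    dist u y + (dist y v + dist v w) ≡⟨ sym (+-assoc (dist u y) (dist y v) (dist v w)) ⟩
    dist u y + dist y v + dist v w   ≡⟨ cong (_+ dist v w) y∈I ⟩
    dist u v + dist v w              ≡⟨ v∈I ⟩
    dist u w                         ≤⟨ dist-triangle u y w ⟩
    dist u y + dist y w              ∎))
    where open ≤-Reasoning

  steps⇒dist≤ : ∀ {p ℓ} → Steps p ℓ → ∀ i d → i + d ≤ ℓ → dist (p i) (p (i + d)) ≤ d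
  steps⇒dist≤ {p} _     i zero    _ = ≤-reflexive (trans (cong (dist (p i) ∘ p) (+-identityʳ i)) (dist-refl (p i)))
  steps⇒dist≤ {p} {ℓ} steps i (suc d) i+d<ℓ = begin
    dist (p i) (p (i + suc d))                 ≡⟨ cong (dist (p i) ∘ p) (+-suc i d) ⟩
    dist (p i) (p (suc (i + d)))               ≤⟨ dist-triangle (p i) (p (i + d)) (p (suc (i + d))) ⟩
    dist (p i) (p (i + d)) + dist (p (i + d)) (p (suc (i + d)))
      ≤⟨ +-mono-≤ (steps⇒dist≤ steps i d (<⇒≤ i+d<ℓ′)) (Adj⇒dist≤1 (steps (i + d) i+d<ℓ′)) ⟩
    d + 1                                      ≡⟨ +-comm d 1 ⟩
    suc d                                      ∎
    where
    open ≤-Reasoning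
    i+d<ℓ′ : i + d < ℓ
    i+d<ℓ′ = subst (_≤ ℓ) (+-suc i d) i+d<ℓ

  record Geodesic (p : ℕ → Vertex) (ℓ : ℕ) (y z : Vertex) : Set where
    field
      start   : p 0 ≡ y
      end     : p ℓ ≡ z
      segment : ∀ i d → i + d ≤ ℓ → dist (p i) (p (i + d)) ≡ d

    dist-start : ∀ {i} → i ≤ ℓ → dist y (p i) ≡ i
    dist-start {i} i≤ℓ = subst (λ y → dist y (p i) ≡ i) start (segment 0 i i≤ℓ)

    dist-end : ∀ {i r} → i + r ≡ ℓ → dist (p i) z ≡ r
    dist-end {i} {r} i+r≡ℓ =
      subst (λ z → dist (p i) z ≡ r) (trans (cong p i+r≡ℓ) end) (segment i r (≤-reflexive i+r≡ℓ))

    length : dist y z ≡ ℓ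
    length = subst (λ y → dist y z ≡ ℓ) start (dist-end refl)

    ∈I : ∀ {i} → i ≤ ℓ → p i ∈ I⟨ y , z ⟩
    ∈I {i} i≤ℓ = begin
      dist y (p i) + dist (p i) z ≡⟨ cong₂ _+_ (dist-start i≤ℓ) (dist-end (m+[n∸m]≡n i≤ℓ)) ⟩
      i + (ℓ ∸ i)                 ≡⟨ m+[n∸m]≡n i≤ℓ ⟩
      ℓ                           ≡⟨ sym length ⟩
      dist y z                    ∎
      where open ≡-Reasoning

    steps : Steps p ℓ
    steps i i<ℓ = dist≤1∧≢⇒Adj (≤-reflexive d≡1) λ pᵢ≡pᵢ₊₁ →
      0≢1+n (trans (sym (dist-refl (p i))) (trans (cong (dist (p i)) pᵢ≡pᵢ₊₁) d≡1))
      where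
      d≡1 : dist (p i) (p (suc i)) ≡ 1
      d≡1 = subst (λ j → dist (p i) (p j) ≡ 1) (+-comm i 1) (segment i 1 (subst (_≤ ℓ) (+-comm 1 i) i<ℓ))

  steps⇒geodesic : ∀ {p ℓ y z} → Steps p ℓ → p 0 ≡ y → p ℓ ≡ z → dist y z ≡ ℓ → Geodesic p ℓ y z
  steps⇒geodesic {p} {ℓ} {y} {z} steps p₀≡y pℓ≡z d≡ℓ = record
    { start = p₀≡y ; end = pℓ≡z ; segment = segment }
    where
    segment : ∀ i d → i + d ≤ ℓ → dist (p i) (p (i + d)) ≡ d
    segment i d i+d≤ℓ = ≤-antisym (steps⇒dist≤ steps i d i+d≤ℓ)
      (+-cancelʳ-≤ e d D (+-cancelˡ-≤ i (d + e) (D + e) (begin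
        i + (d + e)                                     ≡⟨ sym (+-assoc i d e) ⟩
        i + d + e                                       ≡⟨ i+d+e≡ℓ ⟩
        ℓ                                               ≡⟨ sym d≡ℓ ⟩
        dist y z                                        ≡⟨ cong₂ dist (sym p₀≡y) (sym pℓ≡z) ⟩
        dist (p 0) (p ℓ)                                ≤⟨ dist-triangle (p 0) (p i) (p ℓ) ⟩
        dist (p 0) (p i) + dist (p i) (p ℓ)
          ≤⟨ +-monoʳ-≤ (dist (p 0) (p i)) (dist-triangle (p i) (p (i + d)) (p ℓ)) ⟩
        dist (p 0) (p i) + (D + dist (p (i + d)) (p ℓ))
          ≤⟨ +-mono-≤ (steps⇒dist≤ steps 0 i (≤-trans (m≤m+n i d) i+d≤ℓ)) (+-monoʳ-≤ D tail≤e) ⟩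
        i + (D + e)                                     ∎)))
      where
      open ≤-Reasoning
      e D : ℕ
      e = ℓ ∸ (i + d)
      D = dist (p i) (p (i + d))
      i+d+e≡ℓ : i + d + e ≡ ℓ
      i+d+e≡ℓ = m+[n∸m]≡n i+d≤ℓ
      tail≤e : dist (p (i + d)) (p ℓ) ≤ e
      tail≤e = subst (λ j → dist (p (i + d)) (p j) ≤ e) i+d+e≡ℓ
                     (steps⇒dist≤ steps (i + d) e (≤-reflexive i+d+e≡ℓ))

  geodesic-between : ∀ y z → ∃ λ p → Geodesic p (dist y z) y z
  geodesic-between y z = vertexAt W ,
    steps⇒geodesic (vertexAt-steps W) (vertexAt-start W) (vertexAt-end W) refl
    where
    W : Walk G y z (dist y z)
    W = dist-walk y z

  geodesic-reverse : ∀ {p ℓ y z} → Geodesic p ℓ y z → Geodesic (λ i → p (ℓ ∸ i)) ℓ z y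
  geodesic-reverse {p} {ℓ} P = record
    { start   = end
    ; end     = trans (cong p (n∸n≡0 ℓ)) start
    ; segment = segment′ }
    where
    open Geodesic P
    segment′ : ∀ i d → i + d ≤ ℓ → dist (p (ℓ ∸ i)) (p (ℓ ∸ (i + d))) ≡ d
    segment′ i d i+d≤ℓ = begin
      dist (p (ℓ ∸ i)) (p j)       ≡⟨ cong (λ k → dist (p k) (p j)) ℓ∸i≡j+d ⟩
      dist (p (j + d)) (p j)       ≡⟨ dist-sym (p (j + d)) (p j) ⟩
      dist (p j) (p (j + d))       ≡⟨ segment j d (subst (_≤ ℓ) ℓ∸i≡j+d (m∸n≤m ℓ i)) ⟩
      d                            ∎
      where
      open ≡-Reasoning
      j : ℕ
      j = ℓ ∸ (i + d)
      ℓ∸i≡j+d : ℓ ∸ i ≡ j + d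
      ℓ∸i≡j+d = begin
        ℓ ∸ i          ≡⟨ sym (m∸n+n≡m (m+n≤o⇒m≤o∸n d (subst (_≤ ℓ) (+-comm i d) i+d≤ℓ))) ⟩
        ℓ ∸ i ∸ d + d  ≡⟨ cong (_+ d) (∸-+-assoc ℓ i d) ⟩
        j + d          ∎

  geodesic-slice : ∀ {p ℓ y z} c {ℓ′} → Geodesic p ℓ y z → c + ℓ′ ≤ ℓ →
          Geodesic (λ i → p (c + i)) ℓ′ (p c) (p (c + ℓ′))
  geodesic-slice {p} c {ℓ′} P c+ℓ′≤ℓ = record
    { start   = cong p (+-identityʳ c)
    ; end     = refl
    ; segment = λ i d i+d≤ℓ′ →
        subst (λ k → dist (p (c + i)) (p k) ≡ d) (+-assoc c i d)
              (segment (c + i) d (≤-trans (≤-reflexive (+-assoc c i d))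
                                          (≤-trans (+-monoʳ-≤ c i+d≤ℓ′) c+ℓ′≤ℓ))) }
    where open Geodesic P

  Chordless : (ℕ → Vertex) → ℕ → Set
  Chordless p ℓ = ∀ i j → i < j → j ≤ ℓ → dist (p i) (p j) ≤ 1 → suc i ≡ j

  record InducedPath (p : ℕ → Vertex) (ℓ : ℕ) : Set where
    field
      steps     : Steps p ℓ
      chordless : Chordless p ℓ

    injective : ∀ {i j} → i < j → j ≤ ℓ → p i ≢ p j
    injective {i} {j} i<j j≤ℓ pᵢ≡pⱼ =
      Adj⇒≢ (subst (λ k → Adj G (p i) (p k)) 1+i≡j (steps i (<-≤-trans i<j j≤ℓ))) pᵢ≡pⱼ
      where
      1+i≡j : suc i ≡ j
      1+i≡j = chordless i j i<j j≤ℓ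
        (≤-trans (≤-reflexive (trans (cong (dist (p i)) (sym pᵢ≡pⱼ)) (dist-refl (p i)))) z≤n)

  geodesic⇒induced : ∀ {p ℓ y z} → Geodesic p ℓ y z → InducedPath p ℓ
  geodesic⇒induced {p} {ℓ} P = record { steps = steps ; chordless = chordless }
    where
    open Geodesic P
    chordless : Chordless p ℓ
    chordless i j i<j j≤ℓ d≤1 with m≤n⇒∃[o]m+o≡n (<⇒≤ i<j)
    ... | d , refl = ≤-antisym i<j (begin
      i + d  ≤⟨ +-monoʳ-≤ i (subst (_≤ 1) (segment i d j≤ℓ) d≤1) ⟩
      i + 1  ≡⟨ +-comm i 1 ⟩
      suc i  ∎)
      where open ≤-Reasoning

  induced-path-slice : ∀ {p ℓ} c {ℓ′} → InducedPath p ℓ → c + ℓ′ ≤ ℓ →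
                       InducedPath (λ i → p (c + i)) ℓ′
  induced-path-slice {p} {ℓ} c {ℓ′} P c+ℓ′≤ℓ = record
    { steps = Steps-slice c steps c+ℓ′≤ℓ ; chordless = chordless′ }
    where
    open InducedPath P
    chordless′ : Chordless (λ i → p (c + i)) ℓ′
    chordless′ i j i<j j≤ℓ′ d≤1 = +-cancelˡ-≡ c (suc i) j (trans (+-suc c i)
      (chordless (c + i) (c + j) (+-monoʳ-< c i<j) (≤-trans (+-monoʳ-≤ c j≤ℓ′) c+ℓ′≤ℓ) d≤1))

  overlap-separates : ∀ {p a m b y z y′ z′} →
    Geodesic p (a + m) y z → Geodesic (λ i → p (a + i)) (m + b) y′ z′ →
    ∀ {i j} → i < a → a + m < j → j ≤ a + (m + b) → m ≤ dist (p i) (p j)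
  overlap-separates {p} {a} {m} {b} L R {i} {j} i<a a+m<j j≤N = cancel tri₁ tri₂
    where
    open ≤-Reasoning
    r e D : ℕ
    r = a ∸ i
    e = j ∸ (a + m)
    D = dist (p i) (p j)
    i+r≡a : i + r ≡ a
    i+r≡a = m+[n∸m]≡n (<⇒≤ i<a)
    a+[m+e]≡j : a + (m + e) ≡ j
    a+[m+e]≡j = trans (sym (+-assoc a m e)) (m+[n∸m]≡n (<⇒≤ a+m<j))
    m+e≤m+b : m + e ≤ m + b
    m+e≤m+b = +-cancelˡ-≤ a _ _ (subst (_≤ a + (m + b)) (sym a+[m+e]≡j) j≤N)
    i+[r+m]≡a+m : i + (r + m) ≡ a + m
    i+[r+m]≡a+m = trans (sym (+-assoc i r m)) (cong (_+ m) i+r≡a)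
    dᵢₐ : dist (p i) (p a) ≡ r
    dᵢₐ = subst (λ k → dist (p i) (p k) ≡ r) i+r≡a
            (Geodesic.segment L i r (≤-trans (≤-reflexive i+r≡a) (m≤m+n a m)))
    dᵢₐₘ : dist (p i) (p (a + m)) ≡ r + m
    dᵢₐₘ = subst (λ k → dist (p i) (p k) ≡ r + m) i+[r+m]≡a+m
             (Geodesic.segment L i (r + m) (≤-reflexive i+[r+m]≡a+m))
    dₐⱼ : dist (p a) (p j) ≡ m + e
    dₐⱼ = subst₂ (λ k k′ → dist (p k) (p k′) ≡ m + e) (+-identityʳ a) a+[m+e]≡j
            (Geodesic.segment R 0 (m + e) m+e≤m+b)
    dₐₘⱼ : dist (p (a + m)) (p j) ≡ e
    dₐₘⱼ = subst (λ k → dist (p (a + m)) (p k) ≡ e) a+[m+e]≡j (Geodesic.segment R m e m+e≤m+b)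
    tri₁ : r + m ≤ D + e
    tri₁ = begin
      r + m                               ≡⟨ sym dᵢₐₘ ⟩
      dist (p i) (p (a + m))              ≤⟨ dist-triangle (p i) (p j) (p (a + m)) ⟩
      D + dist (p j) (p (a + m))          ≡⟨ cong (D +_) (trans (dist-sym (p j) (p (a + m))) dₐₘⱼ) ⟩
      D + e                               ∎
    tri₂ : m + e ≤ r + D
    tri₂ = begin
      m + e                               ≡⟨ sym dₐⱼ ⟩
      dist (p a) (p j)                    ≤⟨ dist-triangle (p a) (p i) (p j) ⟩
      dist (p a) (p i) + D                ≡⟨ cong (_+ D) (trans (dist-sym (p a) (p i)) dᵢₐ) ⟩
      r + D                               ∎
    cancel : ∀ {r m e D} → r + m ≤ D + e → m + e ≤ r + D → m ≤ D
    cancel {r} {m} {e} {D} h₁ h₂ =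
      m+m≤n+n⇒m≤n (linear-combination (h₁ ⊕ h₂) (solve (r ∷ m ∷ e ∷ D ∷ [])))

  overlapping-geodesics⇒induced : ∀ {p a m b y z y′ z′} → 2 ≤ m →
    Geodesic p (a + m) y z → Geodesic (λ i → p (a + i)) (m + b) y′ z′ → InducedPath p (a + (m + b))
  overlapping-geodesics⇒induced {p} {a} {m} {b} 2≤m L R = record { steps = steps ; chordless = chordless }
    where
    steps : Steps p (a + (m + b))
    steps i i<N with a ≤? i
    ... | no a≰i = Geodesic.steps L i (≤-trans (≰⇒> a≰i) (m≤m+n a m))
    ... | yes a≤i with m≤n⇒∃[o]m+o≡n a≤i
    ...   | i′ , refl = subst (λ k → Adj G (p (a + i′)) (p k)) (+-suc a i′)
            (Geodesic.steps R i′ (+-cancelˡ-≤ a (suc i′) (m + b) (subst (_≤ a + (m + b)) (sym (+-suc a i′)) i<N)))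
    chordless : Chordless p (a + (m + b))
    chordless i j i<j j≤N d≤1 with j ≤? a + m | a ≤? i
    ... | yes j≤a+m | _ = InducedPath.chordless (geodesic⇒induced L) i j i<j j≤a+m d≤1
    ... | no _ | yes a≤i with m≤n⇒∃[o]m+o≡n a≤i | m≤n⇒∃[o]m+o≡n (≤-trans a≤i (<⇒≤ i<j))
    ...   | i′ , refl | j′ , refl = trans (sym (+-suc a i′)) (cong (a +_)
            (InducedPath.chordless (geodesic⇒induced R) i′ j′
              (+-cancelˡ-< a i′ j′ i<j) (+-cancelˡ-≤ a j′ (m + b) j≤N) d≤1))
    chordless i j i<j j≤N d≤1 | no j≰a+m | no a≰i =
      ⊥-elim (<⇒≱ 2≤m (≤-trans (overlap-separates L R (≰⇒> a≰i) (≰⇒> j≰a+m) j≤N) d≤1))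
  bow-path : ∀ {u v w x} → v ∈ I⟨ u , w ⟩ → w ∈ I⟨ v , x ⟩ →
    ∃ λ p → Geodesic p (dist u v + dist v w) u w ×
            Geodesic (λ i → p (dist u v + i)) (dist v w + dist w x) v x
  bow-path {u} {v} {w} {x} v∈I w∈I = p , left , right
    where
    a m b : ℕ
    a = dist u v
    m = dist v w
    b = dist w x
    p₁ p₂ p₃ r p : ℕ → Vertex
    p₁ = proj₁ (geodesic-between u v)
    p₂ = proj₁ (geodesic-between v w)
    p₃ = proj₁ (geodesic-between w x)
    r = splice m p₂ p₃
    p = splice a p₁ r
    module P₁ = Geodesic (proj₂ (geodesic-between u v))
    module P₂ = Geodesic (proj₂ (geodesic-between v w))
    module P₃ = Geodesic (proj₂ (geodesic-between w x))
    p₂-p₃ : p₂ m ≡ p₃ 0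
    p₂-p₃ = trans P₂.end (sym P₃.start)
    r₀≡v : r 0 ≡ v
    r₀≡v = trans (splice-zero m p₂ p₃ p₂-p₃) P₂.start
    p₁-r : p₁ a ≡ r 0
    p₁-r = trans P₁.end (sym r₀≡v)
    steps : Steps p (a + (m + b))
    steps = splice-steps P₁.steps (splice-steps P₂.steps P₃.steps p₂-p₃) p₁-r
    left : Geodesic p (a + m) u w
    left = steps⇒geodesic (Steps-slice 0 steps (+-monoʳ-≤ a (m≤m+n m b)))
      (trans (splice-zero a p₁ r p₁-r) P₁.start)
      (trans (splice-+ a p₁ r m) (trans (cong r (sym (+-identityʳ m))) (trans (splice-+ m p₂ p₃ 0) P₃.start)))
      (sym v∈I)
    right : Geodesic (λ i → p (a + i)) (m + b) v x
    right = steps⇒geodesic (Steps-slice a steps ≤-refl)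
      (trans (splice-+ a p₁ r 0) r₀≡v)
      (trans (splice-+ a p₁ r (m + b)) (trans (splice-+ m p₂ p₃ b) P₃.end))
      (sym w∈I)

  module _ {f g : ℕ → Vertex} {A B : ℕ} (f-path : InducedPath f A) (g-path : InducedPath g B)
           (edgeᶠᵍ : Adj G (f A) (g 0)) (edgeᵍᶠ : Adj G (g B) (f 0))
           (links : ∀ i r → i ≤ A → r ≤ B → dist (f i) (g r) ≤ 1 →
                    (i ≡ A × r ≡ 0) ⊎ (i ≡ 0 × r ≡ B))
           where

    private
      module F = InducedPath f-path
      module H = InducedPath g-path

      c : ℕ → Vertex
      c = splice (suc A) f g

      L : ℕ
      L = suc A + suc B

      data Position (i : ℕ) : Set where
        on-f : i ≤ A → c i ≡ f i → Position i
        on-g : ∀ r → suc A + r ≡ i → r ≤ B → c i ≡ g r → Position i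

      position : ∀ i → i < L → Position i
      position i i<L with i <? suc A
      ... | yes i<1+A = on-f (≤-pred i<1+A) (splice-< (suc A) f g i<1+A)
      ... | no i≮1+A with m≤n⇒∃[o]m+o≡n (≮⇒≥ i≮1+A)
      ...   | r , refl = on-g r refl r≤B (splice-+ (suc A) f g r)
        where
        r≤B : r ≤ B
        r≤B = ≤-pred (+-cancelˡ-≤ (suc A) (suc r) (suc B)
                (subst (_≤ L) (sym (+-suc (suc A) r)) i<L))

      g-after-f : ∀ {r j} → suc A + r < j → ¬ j ≤ A
      g-after-f {r} 1+A+r<j j≤A = <⇒≱ (≤-<-trans (m≤m+n (suc A) r) 1+A+r<j) (m≤n⇒m≤1+n j≤A)

      junction : ∀ {i r} → i ≤ A → suc A + r ≡ suc i → i ≡ A × r ≡ 0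
      junction {i} {r} i≤A 1+A+r≡1+i = i≡A , r≡0
        where
        A+r≡i : A + r ≡ i
        A+r≡i = suc-injective 1+A+r≡1+i
        r≡0 : r ≡ 0
        r≡0 = n≤0⇒n≡0 (+-cancelˡ-≤ A r 0 (subst₂ _≤_ (sym A+r≡i) (sym (+-identityʳ A)) i≤A))
        i≡A : i ≡ A
        i≡A = trans (sym A+r≡i) (trans (cong (A +_) r≡0) (+-identityʳ A))

      steps : ∀ i → suc i < L → Adj G (c i) (c (suc i))
      steps i 1+i<L with position i (<-trans (n<1+n i) 1+i<L) | position (suc i) 1+i<L
      ... | on-f _ cᵢ | on-f 1+i≤A c₁₊ᵢ = subst₂ (Adj G) (sym cᵢ) (sym c₁₊ᵢ) (F.steps i 1+i≤A)
      ... | on-f i≤A cᵢ | on-g r 1+A+r≡1+i _ c₁₊ᵢ with junction i≤A 1+A+r≡1+i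
      ...   | refl , refl = subst₂ (Adj G) (sym cᵢ) (sym c₁₊ᵢ) edgeᶠᵍ
      steps i 1+i<L | on-g r refl _ _ | on-f 1+i≤A _ = ⊥-elim (g-after-f (n<1+n _) 1+i≤A)
      steps i 1+i<L | on-g r refl _ cᵢ | on-g r′ 1+A+r′≡1+i r′≤B c₁₊ᵢ
        with +-cancelˡ-≡ (suc A) r′ (suc r) (trans 1+A+r′≡1+i (sym (+-suc (suc A) r)))
      ... | refl = subst₂ (Adj G) (sym cᵢ) (sym c₁₊ᵢ) (H.steps r r′≤B)

      chords : ∀ i j → i < j → j < L → Adj G (c i) (c j) → suc i ≡ j ⊎ (i ≡ 0 × suc j ≡ L)
      chords i j i<j j<L e with position i (<-trans i<j j<L) | position j j<L
      ... | on-f _ cᵢ | on-f j≤A cⱼ =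
        inj₁ (F.chordless i j i<j j≤A (Adj⇒dist≤1 (subst₂ (Adj G) cᵢ cⱼ e)))
      ... | on-f i≤A cᵢ | on-g r refl r≤B cⱼ with links i r i≤A r≤B (Adj⇒dist≤1 (subst₂ (Adj G) cᵢ cⱼ e))
      ...   | inj₁ (refl , refl) = inj₁ (sym (+-identityʳ (suc A)))
      ...   | inj₂ (refl , refl) = inj₂ (refl , sym (+-suc (suc A) B))
      chords i j i<j j<L e | on-g r refl _ _ | on-f j≤A _ = ⊥-elim (g-after-f i<j j≤A)
      chords i j i<j j<L e | on-g r refl _ cᵢ | on-g r′ refl r′≤B cⱼ =
        inj₁ (trans (sym (+-suc (suc A) r)) (cong (suc A +_)
          (H.chordless r r′ (+-cancelˡ-< (suc A) r r′ i<j) r′≤B (Adj⇒dist≤1 (subst₂ (Adj G) cᵢ cⱼ e)))))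

      distinct : ∀ i j → i < j → j < L → c i ≢ c j
      distinct i j i<j j<L cᵢ≡cⱼ with position i (<-trans i<j j<L) | position j j<L
      ... | on-f _ cᵢ | on-f j≤A cⱼ = F.injective i<j j≤A (trans (sym cᵢ) (trans cᵢ≡cⱼ cⱼ))
      ... | on-f i≤A cᵢ | on-g r refl r≤B cⱼ with links i r i≤A r≤B d≤1
        where
        d≤1 : dist (f i) (g r) ≤ 1
        d≤1 = ≤-trans (≤-reflexive (trans (cong (dist (f i)) (trans (sym cⱼ) (trans (sym cᵢ≡cⱼ) cᵢ)))
                                          (dist-refl (f i)))) z≤n
      ...   | inj₁ (refl , refl) = Adj⇒≢ edgeᶠᵍ (trans (sym cᵢ) (trans cᵢ≡cⱼ cⱼ))
      ...   | inj₂ (refl , refl) = Adj⇒≢ edgeᵍᶠ (trans (sym cⱼ) (trans (sym cᵢ≡cⱼ) cᵢ))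
      distinct i j i<j j<L cᵢ≡cⱼ | on-g r refl _ _ | on-f j≤A _ = g-after-f i<j j≤A
      distinct i j i<j j<L cᵢ≡cⱼ | on-g r refl _ cᵢ | on-g r′ refl r′≤B cⱼ =
        H.injective (+-cancelˡ-< (suc A) r r′ i<j) r′≤B (trans (sym cᵢ) (trans cᵢ≡cⱼ cⱼ))

      closing : Adj G (c (L ∸ 1)) (c 0)
      closing = subst (λ v → Adj G v (f 0))
        (sym (trans (cong c (+-suc A B)) (splice-+ (suc A) f g B))) edgeᵍᶠ

    spliced-cycle : 1 ≤ A + B → IsInducedCycle G (suc A + suc B) (splice (suc A) f g ∘ toℕ)
    spliced-cycle 1≤A+B = isInducedCycle c L 3≤L steps closing chords distinct
      where
      3≤L : 3 ≤ L
      3≤L = s≤s (≤-trans (s≤s 1≤A+B) (≤-reflexive (sym (+-suc A B))))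

module Ladder {n : ℕ} {G : Graph n} (conn : Connected G) where
  open GraphBasics G
  open Distance conn

  module _ {u v x : Vertex} {a l : ℕ} {p q : ℕ → Vertex}
           (P : Geodesic p a u v) (Q : Geodesic q l u x)
           (thin : ∀ y → y ∈ I⟨ u , x ⟩ → y ∈ I⟨ u , v ⟩ → y ≡ u)
           where

    private
      module P = Geodesic P
      module Q = Geodesic Q

    q≢u : ∀ {σ} → 1 ≤ σ → σ ≤ l → q σ ≢ u
    q≢u {σ} 1≤σ σ≤l q≡u = <⇒≱ 1≤σ (≤-reflexive (begin
      σ            ≡⟨ sym (Q.dist-start σ≤l) ⟩
      dist u (q σ) ≡⟨ cong (dist u) q≡u ⟩
      dist u u     ≡⟨ dist-refl u ⟩
      0            ∎))
      where open ≡-Reasoning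

    near-rung-< : ∀ {σ j} → σ ≤ l → j ≤ a → j < σ → dist (q σ) (p j) ≤ 1 → j ≡ 0 × σ ≡ 1
    near-rung-< {σ} {j} σ≤l j≤a j<σ d≤1 = j≡0 , trans σ≡1+j (cong suc j≡0)
      where
      open ≤-Reasoning
      σ≡1+j : σ ≡ suc j
      σ≡1+j = ≤-antisym (begin
        σ                          ≡⟨ sym (Q.dist-start σ≤l) ⟩
        dist u (q σ)               ≤⟨ dist-triangle u (p j) (q σ) ⟩
        dist u (p j) + dist (p j) (q σ)
          ≤⟨ ≤-reflexive (P.dist-start j≤a) ⊕ subst (_≤ 1) (dist-sym (q σ) (p j)) d≤1 ⟩
        j + 1                      ≡⟨ +-comm j 1 ⟩
        suc j                      ∎) j<σ
      pⱼ∈I⟨u,x⟩ : p j ∈ I⟨ u , x ⟩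
      pⱼ∈I⟨u,x⟩ = ≤⇒∈I (begin
        dist u (p j) + dist (p j) x
          ≤⟨ +-monoʳ-≤ (dist u (p j)) (dist-triangle (p j) (q σ) x) ⟩
        dist u (p j) + (dist (p j) (q σ) + dist (q σ) x)
          ≤⟨ ≤-reflexive (P.dist-start j≤a)
               ⊕ subst (_≤ 1) (dist-sym (q σ) (p j)) d≤1 ⊕ ≤-reflexive (Q.dist-end (m+[n∸m]≡n σ≤l)) ⟩
        j + (1 + (l ∸ σ))          ≡⟨ +-suc j (l ∸ σ) ⟩
        suc j + (l ∸ σ)            ≡⟨ cong (_+ (l ∸ σ)) (sym σ≡1+j) ⟩
        σ + (l ∸ σ)                ≡⟨ m+[n∸m]≡n σ≤l ⟩
        l                          ≡⟨ sym Q.length ⟩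
        dist u x                   ∎)
      j≡0 : j ≡ 0
      j≡0 = begin-equality
        j             ≡⟨ sym (P.dist-start j≤a) ⟩
        dist u (p j)  ≡⟨ cong (dist u) (thin (p j) pⱼ∈I⟨u,x⟩ (P.∈I j≤a)) ⟩
        dist u u      ≡⟨ dist-refl u ⟩
        0             ∎

    near-rung-> : ∀ {σ j} → 1 ≤ σ → σ ≤ l → j ≤ a → σ < j → ¬ dist (q σ) (p j) ≤ 1
    near-rung-> {σ} {j} 1≤σ σ≤l j≤a σ<j d≤1 = q≢u 1≤σ σ≤l (thin (q σ) (Q.∈I σ≤l) qσ∈I⟨u,v⟩)
      where
      open ≤-Reasoning
      j≡1+σ : j ≡ suc σ
      j≡1+σ = ≤-antisym (begin
        j                          ≡⟨ sym (P.dist-start j≤a) ⟩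
        dist u (p j)               ≤⟨ dist-triangle u (q σ) (p j) ⟩
        dist u (q σ) + dist (q σ) (p j)
          ≤⟨ ≤-reflexive (Q.dist-start σ≤l) ⊕ d≤1 ⟩
        σ + 1                      ≡⟨ +-comm σ 1 ⟩
        suc σ                      ∎) σ<j
      qσ∈I⟨u,v⟩ : q σ ∈ I⟨ u , v ⟩
      qσ∈I⟨u,v⟩ = ≤⇒∈I (begin
        dist u (q σ) + dist (q σ) v
          ≤⟨ +-monoʳ-≤ (dist u (q σ)) (dist-triangle (q σ) (p j) v) ⟩
        dist u (q σ) + (dist (q σ) (p j) + dist (p j) v)
          ≤⟨ ≤-reflexive (Q.dist-start σ≤l) ⊕ d≤1 ⊕ ≤-reflexive (P.dist-end (m+[n∸m]≡n j≤a)) ⟩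
        σ + (1 + (a ∸ j))          ≡⟨ +-suc σ (a ∸ j) ⟩
        suc σ + (a ∸ j)            ≡⟨ cong (_+ (a ∸ j)) (sym j≡1+σ) ⟩
        j + (a ∸ j)                ≡⟨ m+[n∸m]≡n j≤a ⟩
        a                          ≡⟨ sym P.length ⟩
        dist u v                   ∎)

    near-rung : ∀ {σ j} → 1 ≤ σ → σ ≤ l → j ≤ a → dist (q σ) (p j) ≤ 1 →
                j ≡ σ ⊎ (j ≡ 0 × σ ≡ 1)
    near-rung {σ} {j} 1≤σ σ≤l j≤a d≤1 with <-cmp j σ
    ... | tri≈ _ j≡σ _ = inj₁ j≡σ
    ... | tri< j<σ _ _ = inj₂ (near-rung-< σ≤l j≤a j<σ d≤1)
    ... | tri> _ _ σ<j = ⊥-elim (near-rung-> 1≤σ σ≤l j≤a σ<j d≤1)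

    record LastRung : Set where
      field
        s s′    : ℕ
        s<a     : s < a
        1≤s′    : 1 ≤ s′
        s′≤l    : s′ ≤ l
        s′≤1+s  : s′ ≤ suc s
        rung    : Adj G (q s′) (p s)
        beyond  : ∀ σ j → s′ ≤ σ → σ ≤ l → s ≤ j → j < a →
                  dist (q σ) (p j) ≤ 1 → j ≡ s × σ ≡ s′

      detour : dist v x ≤ (a ∸ s) + suc (l ∸ s′)
      detour = begin
        dist v x                                ≤⟨ dist-triangle v (p s) x ⟩
        dist v (p s) + dist (p s) x             ≤⟨ +-monoʳ-≤ (dist v (p s)) (dist-triangle (p s) (q s′) x) ⟩
        dist v (p s) + (dist (p s) (q s′) + dist (q s′) x)
          ≤⟨ +-mono-≤ (≤-reflexive (trans (dist-sym v (p s)) (P.dist-end (m+[n∸m]≡n (<⇒≤ s<a)))))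
                      (+-mono-≤ (Adj⇒dist≤1 (Adj-sym rung)) (≤-reflexive (Q.dist-end (m+[n∸m]≡n s′≤l)))) ⟩
        (a ∸ s) + suc (l ∸ s′)                  ∎
        where open ≤-Reasoning

    last-rung : 1 ≤ a → 1 ≤ l → LastRung
    last-rung 1≤a 1≤l with last-satisfying (λ σ → σ ≤? l ×-dec dist (q σ) (p σ) ≤? 1) (pred a)
    ... | inj₁ no-rung = record
      { s = 0 ; s′ = 1 ; s<a = 1≤a ; 1≤s′ = ≤-refl ; s′≤l = 1≤l ; s′≤1+s = ≤-refl
      ; rung = subst (Adj G (q 1)) (trans Q.start (sym P.start)) (Adj-sym (Q.steps 0 1≤l))
      ; beyond = beyond }
      where
      beyond : ∀ σ j → 1 ≤ σ → σ ≤ l → 0 ≤ j → j < a → dist (q σ) (p j) ≤ 1 → j ≡ 0 × σ ≡ 1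
      beyond σ j 1≤σ σ≤l _ j<a d≤1 with near-rung 1≤σ σ≤l (<⇒≤ j<a) d≤1
      ... | inj₁ refl     = ⊥-elim (no-rung j 1≤σ (<⇒≤pred j<a) (σ≤l , d≤1))
      ... | inj₂ j≡0,σ≡1 = j≡0,σ≡1
    ... | inj₂ (s , 1≤s , s≤a-1 , (s≤l , near) , no-later-rung) = record
      { s = s ; s′ = s ; s<a = m≤pred[n]⇒suc[m]≤n {{>-nonZero 1≤a}} s≤a-1 ; 1≤s′ = 1≤s ; s′≤l = s≤l
      ; s′≤1+s = n≤1+n s
      ; rung = dist≤1∧≢⇒Adj near λ qₛ≡pₛ →
          q≢u 1≤s s≤l (thin (q s) (Q.∈I s≤l) (subst (_∈ I⟨ u , v ⟩) (sym qₛ≡pₛ) (P.∈I s≤a)))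
      ; beyond = beyond }
      where
      s≤a : s ≤ a
      s≤a = ≤pred⇒≤ s≤a-1
      beyond : ∀ σ j → s ≤ σ → σ ≤ l → s ≤ j → j < a → dist (q σ) (p j) ≤ 1 → j ≡ s × σ ≡ s
      beyond σ j s≤σ σ≤l s≤j j<a d≤1 with near-rung (≤-trans 1≤s s≤σ) σ≤l (<⇒≤ j<a) d≤1
      ... | inj₂ (refl , _) = ⊥-elim (<⇒≱ 1≤s s≤j)
      ... | inj₁ refl with m≤n⇒m<n∨m≡n s≤σ
      ...   | inj₁ s<σ  = ⊥-elim (no-later-rung σ s<σ (<⇒≤pred j<a) (σ≤l , d≤1))
      ...   | inj₂ refl = refl , refl

-- The last rungs, at position s′ of Q counted from u and t′ counted from x, do not cross.
rungs-ordered : ∀ {a b m l s s′ t t′ α β S T} →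
  s + α ≡ a → t + β ≡ b → s′ + S ≡ l → t′ + T ≡ l → s′ ≤ suc s → t′ ≤ suc t → 2 ≤ m →
  m + b ≤ α + suc S → a + m ≤ β + suc T → t′ ≤ S
rungs-ordered {a} {b} {m} {l} {s} {s′} {t} {t′} {α} {β} {S} {T} e₁ e₂ e₃ e₄ h₁ h₂ 2≤m d₁ d₂ =
  m+m≤n+n⇒m≤n (linear-combination
    (d₁ ⊕ d₂ ⊕ ≤-reflexive e₁ ⊕ ≤-reflexive e₂ ⊕ 2≤m ⊕ 2≤m ⊕ h₁ ⊕ h₂
        ⊕ ≤-reflexive e₄ ⊕ ≤-reflexive (sym e₃))
    (solve (a ∷ b ∷ m ∷ l ∷ s ∷ s′ ∷ t ∷ t′ ∷ α ∷ β ∷ S ∷ T ∷ [])))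

cycle-long : ∀ {a b m l μ k t′ α β S T B} →
  m + b ≤ α + suc S → a + m ≤ β + suc T → t′ + T ≡ l → t′ + B ≡ S →
  l + μ < a + (m + b) → k ≤ μ + (m + m) → k < suc (α + (m + β)) + suc B
cycle-long {a} {b} {m} {l} {μ} {k} {t′} {α} {β} {S} {T} {B} d₁ d₂ e₁ e₂ violated k≤ =
  linear-combination (d₁ ⊕ d₂ ⊕ violated ⊕ k≤ ⊕ ≤-reflexive (sym e₂) ⊕ ≤-reflexive e₁)
    (solve (a ∷ b ∷ m ∷ l ∷ μ ∷ k ∷ t′ ∷ α ∷ β ∷ S ∷ T ∷ B ∷ []))

module BowInequality {n : ℕ} {G : Graph n} (conn : Connected G)
                     {k μ : ℕ} (chordal : KChordal G k) (2≤μ : 2 ≤ μ) where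
  open GraphBasics G
  open Distance conn
  open Ladder conn

  span : Vertex → Vertex → Vertex → Vertex → ℕ
  span u v w x = dist u v + (dist v w + dist w x)

  span-reverse : ∀ u v w x → span x w v u ≡ span u v w x
  span-reverse u v w x = begin
    dist x w + (dist w v + dist v u) ≡⟨ cong₂ _+_ (dist-sym x w) (cong₂ _+_ (dist-sym w v) (dist-sym v u)) ⟩
    dist w x + (dist v w + dist u v) ≡⟨ swap (dist u v) (dist v w) (dist w x) ⟩
    span u v w x                     ∎
    where
    open ≡-Reasoning
    swap : ∀ a m b → b + (m + a) ≡ a + (m + b)
    swap a m b = solve (a ∷ m ∷ b ∷ [])

  record Bow (u v w x : Vertex) : Set where
    field
      v∈I⟨u,w⟩ : v ∈ I⟨ u , w ⟩
      w∈I⟨v,x⟩ : w ∈ I⟨ v , x ⟩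
      2≤m      : 2 ≤ dist v w
      k≤μ+2m   : k ≤ μ + (dist v w + dist v w)

  bow-reverse : ∀ {u v w x} → Bow u v w x → Bow x w v u
  bow-reverse {v = v} {w} bow = record
    { v∈I⟨u,w⟩ = ∈I-sym w∈I⟨v,x⟩
    ; w∈I⟨v,x⟩ = ∈I-sym v∈I⟨u,w⟩
    ; 2≤m      = subst (2 ≤_) (dist-sym v w) 2≤m
    ; k≤μ+2m   = subst (λ d → k ≤ μ + (d + d)) (dist-sym v w) k≤μ+2m }
    where open Bow bow

  module _ {u v w x : Vertex} (bow : Bow u v w x) (violated : dist u x + μ < span u v w x)
           (thin-u : ∀ y → y ∈ I⟨ u , x ⟩ → y ∈ I⟨ u , v ⟩ → y ≡ u)
           (thin-x : ∀ y → y ∈ I⟨ x , u ⟩ → y ∈ I⟨ x , w ⟩ → y ≡ x)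
           where

    private
      open Bow bow

      a m b l : ℕ
      a = dist u v
      m = dist v w
      b = dist w x
      l = dist u x

      p : ℕ → Vertex
      p = proj₁ (bow-path v∈I⟨u,w⟩ w∈I⟨v,x⟩)
      L : Geodesic p (a + m) u w
      L = proj₁ (proj₂ (bow-path v∈I⟨u,w⟩ w∈I⟨v,x⟩))
      R : Geodesic (λ i → p (a + i)) (m + b) v x
      R = proj₂ (proj₂ (bow-path v∈I⟨u,w⟩ w∈I⟨v,x⟩))
      q : ℕ → Vertex
      q = proj₁ (geodesic-between u x)
      Q : Geodesic q l u x
      Q = proj₂ (geodesic-between u x)

      Pᵤ : Geodesic p a u v
      Pᵤ = subst₂ (Geodesic p a) (Geodesic.start L) (trans (cong p (sym (+-identityʳ a))) (Geodesic.start R))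
             (geodesic-slice 0 L (m≤m+n a m))
      Pₓ : Geodesic (λ j → p (a + (m + (b ∸ j)))) b x w
      Pₓ = geodesic-reverse (subst₂ (Geodesic (λ i → p (a + (m + i))) b)
             (Geodesic.end L) (Geodesic.end R)
             (geodesic-slice m R ≤-refl))
      Qₓ : Geodesic (λ τ → q (l ∸ τ)) l x u
      Qₓ = geodesic-reverse Q

      u≢v : u ≢ v
      u≢v refl = <⇒≱ violated (begin
        dist u u + (dist u w + dist w x) ≡⟨ cong (_+ (dist u w + dist w x)) (dist-refl u) ⟩
        dist u w + dist w x              ≡⟨ w∈I⟨v,x⟩ ⟩
        dist u x                         ≤⟨ m≤m+n (dist u x) μ ⟩
        dist u x + μ                     ∎)
        where open ≤-Reasoning

      w≢x : w ≢ x
      w≢x refl = <⇒≱ violated (begin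
        dist u v + (dist v w + dist w w) ≡⟨ cong (λ d → dist u v + (dist v w + d)) (dist-refl w) ⟩
        dist u v + (dist v w + 0)        ≡⟨ cong (dist u v +_) (+-identityʳ (dist v w)) ⟩
        dist u v + dist v w              ≡⟨ v∈I⟨u,w⟩ ⟩
        dist u w                         ≤⟨ m≤m+n (dist u w) μ ⟩
        dist u w + μ                     ∎)
        where open ≤-Reasoning

      u≢x : u ≢ x
      u≢x refl = <⇒≱ 2≤m (≤-trans (≤-reflexive (no-loop v∈I⟨u,w⟩ (begin
        dist v w + dist u w ≡⟨ cong (dist v w +_) (dist-sym u w) ⟩
        dist v w + dist w u ≡⟨ w∈I⟨v,x⟩ ⟩
        dist v u            ≡⟨ dist-sym v u ⟩
        dist u v            ∎))) z≤n)
        where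
        open ≡-Reasoning
        no-loop : ∀ {a m c} → a + m ≡ c → m + c ≡ a → m ≡ 0
        no-loop {a} {m} {c} a+m≡c m+c≡a = n≤0⇒n≡0 (m+m≤n+n⇒m≤n (linear-combination
          (+-mono-≤ (≤-reflexive a+m≡c) (≤-reflexive m+c≡a)) (solve (a ∷ m ∷ c ∷ []))))

      -- abstract: unfolding the search performed by last-rung makes type checking very slow.
      abstract
        rungᵤ : LastRung Pᵤ Q thin-u
        rungᵤ = last-rung Pᵤ Q thin-u (≢⇒1≤dist u≢v) (≢⇒1≤dist u≢x)
        rungₓ : LastRung Pₓ Qₓ thin-x
        rungₓ = last-rung Pₓ Qₓ thin-x (≢⇒1≤dist w≢x) (≢⇒1≤dist u≢x)

      module U = LastRung rungᵤ
      module X = LastRung rungₓ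

      s s′ t t′ α β S T : ℕ
      s  = U.s
      s′ = U.s′
      t  = X.s
      t′ = X.s′
      α  = a ∸ s
      β  = b ∸ t
      S  = l ∸ s′
      T  = l ∸ t′

      s+α≡a : s + α ≡ a
      s+α≡a = m+[n∸m]≡n (<⇒≤ U.s<a)
      t+β≡b : t + β ≡ b
      t+β≡b = m+[n∸m]≡n (<⇒≤ X.s<a)
      s′+S≡l : s′ + S ≡ l
      s′+S≡l = m+[n∸m]≡n U.s′≤l
      t′+T≡l : t′ + T ≡ l
      t′+T≡l = m+[n∸m]≡n X.s′≤l

      detourᵤ : m + b ≤ α + suc S
      detourᵤ = subst (_≤ α + suc S) (sym w∈I⟨v,x⟩) U.detour
      detourₓ : a + m ≤ β + suc T
      detourₓ = subst (_≤ β + suc T) (trans (dist-sym w u) (sym v∈I⟨u,w⟩)) X.detour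

      t′≤S : t′ ≤ S
      t′≤S = rungs-ordered s+α≡a t+β≡b s′+S≡l t′+T≡l U.s′≤1+s X.s′≤1+s 2≤m detourᵤ detourₓ

      A B : ℕ
      A = α + (m + β)
      B = S ∸ t′

      t′+B≡S : t′ + B ≡ S
      t′+B≡S = m+[n∸m]≡n t′≤S
      1≤A+B : 1 ≤ A + B
      1≤A+B = ≤-trans (<⇒≤ 2≤m) (≤-trans (m≤m+n m β) (≤-trans (m≤n+m (m + β) α) (m≤m+n A B)))
      s+A≡ : s + A ≡ a + (m + β)
      s+A≡ = trans (sym (+-assoc s α (m + β))) (cong (_+ (m + β)) s+α≡a)
      S≤l : S ≤ l
      S≤l = m∸n≤m l s′

      f g : ℕ → Vertex
      f i = p (s + i)
      g r = q (l ∸ (t′ + r))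

      f-path : InducedPath f A
      f-path = induced-path-slice s (overlapping-geodesics⇒induced 2≤m L R)
        (≤-trans (≤-reflexive s+A≡) (+-monoʳ-≤ a (+-monoʳ-≤ m (m∸n≤m b t))))

      g-path : InducedPath g B
      g-path = geodesic⇒induced (geodesic-slice t′ Qₓ (≤-trans (≤-reflexive t′+B≡S) S≤l))

      edgeᶠᵍ : Adj G (f A) (g 0)
      edgeᶠᵍ = subst₂ (Adj G) (cong p (sym s+A≡)) (cong (λ τ → q (l ∸ τ)) (sym (+-identityʳ t′)))
                 (Adj-sym X.rung)

      edgeᵍᶠ : Adj G (g B) (f 0)
      edgeᵍᶠ = subst₂ (Adj G) (cong q (sym l∸[t′+B]≡s′)) (cong p (sym (+-identityʳ s))) U.rung
        where
        l∸[t′+B]≡s′ : l ∸ (t′ + B) ≡ s′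
        l∸[t′+B]≡s′ = trans (cong (l ∸_) t′+B≡S) (m∸[m∸n]≡n U.s′≤l)

      links-u : ∀ i r → s + i < a → r ≤ B → dist (f i) (g r) ≤ 1 → i ≡ 0 × r ≡ B
      links-u i r J<a r≤B d≤1 = i≡0 , r≡B
        where
        τ≤S : t′ + r ≤ S
        τ≤S = subst (t′ + r ≤_) t′+B≡S (+-monoʳ-≤ t′ r≤B)
        s′≤σ : s′ ≤ l ∸ (t′ + r)
        s′≤σ = m+n≤o⇒m≤o∸n s′ (subst (s′ + (t′ + r) ≤_) s′+S≡l (+-monoʳ-≤ s′ τ≤S))
        corner : s + i ≡ s × l ∸ (t′ + r) ≡ s′
        corner = U.beyond (l ∸ (t′ + r)) (s + i) s′≤σ (m∸n≤m l (t′ + r)) (m≤m+n s i) J<a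
                   (subst (_≤ 1) (dist-sym (f i) (g r)) d≤1)
        i≡0 : i ≡ 0
        i≡0 = +-cancelˡ-≡ s i 0 (trans (proj₁ corner) (sym (+-identityʳ s)))
        r≡B : r ≡ B
        r≡B = +-cancelˡ-≡ t′ r B (begin
          t′ + r                ≡⟨ sym (m∸[m∸n]≡n (≤-trans τ≤S S≤l)) ⟩
          l ∸ (l ∸ (t′ + r))    ≡⟨ cong (l ∸_) (proj₂ corner) ⟩
          S                     ≡⟨ sym t′+B≡S ⟩
          t′ + B                ∎)
          where open ≡-Reasoning

      links-x : ∀ i r → i ≤ A → a + m < s + i → r ≤ B → dist (f i) (g r) ≤ 1 → i ≡ A × r ≡ 0
      links-x i r i≤A a+m<J r≤B d≤1 = i≡A , r≡0
        where
        e j : ℕ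
        e = s + i ∸ (a + m)
        j = b ∸ e
        a+[m+e]≡J : a + (m + e) ≡ s + i
        a+[m+e]≡J = trans (sym (+-assoc a m e)) (m+[n∸m]≡n (<⇒≤ a+m<J))
        e≤β : e ≤ β
        e≤β = +-cancelˡ-≤ m e β (+-cancelˡ-≤ a (m + e) (m + β)
                (≤-trans (≤-reflexive a+[m+e]≡J) (≤-trans (+-monoʳ-≤ s i≤A) (≤-reflexive s+A≡))))
        e≤b : e ≤ b
        e≤b = ≤-trans e≤β (m∸n≤m b t)
        pₓj≡fi : p (a + (m + (b ∸ j))) ≡ f i
        pₓj≡fi = cong p (trans (cong (λ e′ → a + (m + e′)) (m∸[m∸n]≡n e≤b)) a+[m+e]≡J)
        τ≤l : t′ + r ≤ l
        τ≤l = ≤-trans (+-monoʳ-≤ t′ r≤B) (≤-trans (≤-reflexive t′+B≡S) S≤l)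
        corner : j ≡ t × t′ + r ≡ t′
        corner = X.beyond (t′ + r) j (m≤m+n t′ r) τ≤l
                   (m+n≤o⇒m≤o∸n t (subst (t + e ≤_) t+β≡b (+-monoʳ-≤ t e≤β)))
                   (∸-monoʳ-< (m<n⇒0<n∸m a+m<J) e≤b)
                   (subst (λ z → dist (g r) z ≤ 1) (sym pₓj≡fi) (subst (_≤ 1) (dist-sym (f i) (g r)) d≤1))
        r≡0 : r ≡ 0
        r≡0 = +-cancelˡ-≡ t′ r 0 (trans (proj₂ corner) (sym (+-identityʳ t′)))
        i≡A : i ≡ A
        i≡A = +-cancelˡ-≡ s i A (begin
          s + i          ≡⟨ sym a+[m+e]≡J ⟩
          a + (m + e)    ≡⟨ cong (λ e′ → a + (m + e′)) e≡β ⟩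
          a + (m + β)    ≡⟨ sym s+A≡ ⟩
          s + A          ∎)
          where
          open ≡-Reasoning
          e≡β : e ≡ β
          e≡β = trans (sym (m∸[m∸n]≡n e≤b)) (cong (b ∸_) (proj₁ corner))

      middle-far : ∀ {J y} → a ≤ J → J ≤ a + m → y ∈ I⟨ u , x ⟩ → ¬ dist (p J) y ≤ 1
      middle-far {J} {y} a≤J J≤a+m y∈I d≤1 with m≤n⇒∃[o]m+o≡n a≤J
      ... | i , refl = <⇒≱ violated (begin
        a + (m + b)                                         ≡⟨ sym on-bow ⟩
        dist u (p (a + i)) + dist (p (a + i)) x
          ≤⟨ +-mono-≤ (dist-triangle u y (p (a + i))) (dist-triangle (p (a + i)) y x) ⟩
        (dist u y + dist y (p (a + i))) + (dist (p (a + i)) y + dist y x)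
          ≤⟨ +-mono-≤ (+-monoʳ-≤ (dist u y) (subst (_≤ 1) (dist-sym (p (a + i)) y) d≤1))
                      (+-monoˡ-≤ (dist y x) d≤1) ⟩
        (dist u y + 1) + (1 + dist y x)                     ≡⟨ regroup (dist u y) (dist y x) ⟩
        (dist u y + dist y x) + 2                           ≡⟨ cong (_+ 2) y∈I ⟩
        l + 2                                               ≤⟨ +-monoʳ-≤ l 2≤μ ⟩
        l + μ                                               ∎)
        where
        open ≤-Reasoning
        regroup : ∀ c d → (c + 1) + (1 + d) ≡ (c + d) + 2
        regroup c d = solve (c ∷ d ∷ [])
        i≤m : i ≤ m
        i≤m = +-cancelˡ-≤ a i m J≤a+m
        i+[m∸i+b]≡m+b : i + ((m ∸ i) + b) ≡ m + b
        i+[m∸i+b]≡m+b = trans (sym (+-assoc i (m ∸ i) b)) (cong (_+ b) (m+[n∸m]≡n i≤m))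
        on-bow : dist u (p (a + i)) + dist (p (a + i)) x ≡ a + (m + b)
        on-bow = begin-equality
          dist u (p (a + i)) + dist (p (a + i)) x
            ≡⟨ cong₂ _+_ (Geodesic.dist-start L J≤a+m) (Geodesic.dist-end R i+[m∸i+b]≡m+b) ⟩
          a + i + ((m ∸ i) + b)   ≡⟨ +-assoc a i _ ⟩
          a + (i + ((m ∸ i) + b)) ≡⟨ cong (a +_) i+[m∸i+b]≡m+b ⟩
          a + (m + b)             ∎

      links : ∀ i r → i ≤ A → r ≤ B → dist (f i) (g r) ≤ 1 → (i ≡ A × r ≡ 0) ⊎ (i ≡ 0 × r ≡ B)
      links i r i≤A r≤B d≤1 with s + i <? a | s + i ≤? a + m
      ... | yes J<a  | _          = inj₂ (links-u i r J<a r≤B d≤1)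
      ... | no  J≮a  | yes J≤a+m  =
        ⊥-elim (middle-far (≮⇒≥ J≮a) J≤a+m (Geodesic.∈I Q (m∸n≤m l (t′ + r))) d≤1)
      ... | no  _    | no  J≰a+m  = inj₁ (links-x i r i≤A (≰⇒> J≰a+m) r≤B d≤1)

    thin-violation-impossible : ⊥
    thin-violation-impossible =
      <⇒≱ (cycle-long detourᵤ detourₓ t′+T≡l t′+B≡S violated k≤μ+2m)
          (chordal _ _ (spliced-cycle f-path g-path edgeᶠᵍ edgeᵍᶠ links 1≤A+B))

  HoldsBelow : Vertex → Vertex → Set
  HoldsBelow u x = ∀ {u′ v′ w′ x′} → dist u′ x′ < dist u x →
                   Bow u′ v′ w′ x′ → span u′ v′ w′ x′ ≤ dist u′ x′ + μ

  minimal-violation⇒thin : ∀ {u v w x} → HoldsBelow u x → Bow u v w x → dist u x + μ < span u v w x →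
         ∀ y → y ∈ I⟨ u , x ⟩ → y ∈ I⟨ u , v ⟩ → y ≡ u
  minimal-violation⇒thin {u} {v} {w} {x} smaller bow violated y y∈I⟨u,x⟩ y∈I⟨u,v⟩ with y ≟ᶠ u
  ... | yes y≡u = y≡u
  ... | no  y≢u = ⊥-elim (<⇒≱ violated (begin
    dist u v + (dist v w + dist w x)              ≡⟨ cong (_+ (dist v w + dist w x)) (sym y∈I⟨u,v⟩) ⟩
    (dist u y + dist y v) + (dist v w + dist w x) ≡⟨ +-assoc (dist u y) (dist y v) _ ⟩
    dist u y + span y v w x                       ≤⟨ +-monoʳ-≤ (dist u y) (smaller shorter bow′) ⟩
    dist u y + (dist y x + μ)                     ≡⟨ sym (+-assoc (dist u y) (dist y x) μ) ⟩
    (dist u y + dist y x) + μ                     ≡⟨ cong (_+ μ) y∈I⟨u,x⟩ ⟩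
    dist u x + μ                                  ∎))
    where
    open ≤-Reasoning
    shorter : dist y x < dist u x
    shorter = ≤-trans (+-monoˡ-≤ (dist y x) (≢⇒1≤dist (y≢u ∘ sym))) (≤-reflexive y∈I⟨u,x⟩)
    bow′ : Bow y v w x
    bow′ = record
      { v∈I⟨u,w⟩ = ∈I-shrinkˡ y∈I⟨u,v⟩ v∈I⟨u,w⟩
      ; w∈I⟨v,x⟩ = w∈I⟨v,x⟩
      ; 2≤m      = 2≤m
      ; k≤μ+2m   = k≤μ+2m }
      where open Bow bow

  bow-inequality : ∀ {u v w x} → Bow u v w x → span u v w x ≤ dist u x + μ
  bow-inequality {u} {v} {w} {x} = <-rec Bounded step (dist u x) refl
    where
    Bounded : ℕ → Set
    Bounded l = ∀ {u v w x} → dist u x ≡ l → Bow u v w x → span u v w x ≤ dist u x + μ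
    step : ∀ l → (∀ {l′} → l′ < l → Bounded l′) → Bounded l
    step _ IH {u} {v} {w} {x} refl bow with span u v w x ≤? dist u x + μ
    ... | yes bounded   = bounded
    ... | no  unbounded = ⊥-elim (thin-violation-impossible bow violated
                                    (minimal-violation⇒thin smaller bow violated)
                                    (minimal-violation⇒thin smallerʳ (bow-reverse bow) violatedʳ))
      where
      violated : dist u x + μ < span u v w x
      violated = ≰⇒> unbounded
      violatedʳ : dist x u + μ < span x w v u
      violatedʳ = subst₂ (λ d s → d + μ < s) (dist-sym u x) (sym (span-reverse u v w x)) violated
      smaller : HoldsBelow u x
      smaller lt = IH lt refl
      smallerʳ : HoldsBelow x u
      smallerʳ lt = IH (subst (_ <_) (dist-sym x u) lt) refl

k≤k/2+2m : ∀ k {m} → k / 4 < m → k ≤ k / 2 + (m + m)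
k≤k/2+2m k k/4<m = bound {h = k / 2}
  (m≡m%n+[m/n]*n k 2) (≤-pred (m%n<n k 2)) (m≡m%n+[m/n]*n k 4) (≤-pred (m%n<n k 4)) k/4<m
  where
  bound : ∀ {k r₂ h r₄ d m} → k ≡ r₂ + h * 2 → r₂ ≤ 1 → k ≡ r₄ + d * 4 → r₄ ≤ 3 → d < m →
          k ≤ h + (m + m)
  bound {k} {r₂} {h} {r₄} {d} {m} e₂ r₂≤1 e₄ r₄≤3 d<m = m+m≤n+n⇒m≤n (linear-combination
    (≤-reflexive e₂ ⊕ r₂≤1 ⊕ ≤-reflexive e₄ ⊕ r₄≤3 ⊕ d<m ⊕ d<m ⊕ d<m ⊕ d<m)
    (solve (k ∷ r₂ ∷ h ∷ r₄ ∷ d ∷ m ∷ [])))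

proposition6 : (k : ℕ) → 4 ≤ k → ∀ {n} (G : Graph n) → Connected G → KChordal G k →
                 BowMetric G (k / 4) (k / 2)
proposition6 k 4≤k G conn chordal = bow-metric
  where
  open Distance conn
  open BowInequality conn chordal (/-mono-≤ {o = 2} {p = 2} 4≤k ≤-refl)

  bow-metric : BowMetric G (k / 4) (k / 2)
  bow-metric u v w x _ _ _ _ _ _ Duv Dvw Dwx Duw Dvx Dux v∈I w∈I k/4<m
    with Dist⇒≡dist Duv | Dist⇒≡dist Dvw | Dist⇒≡dist Dwx
       | Dist⇒≡dist Duw | Dist⇒≡dist Dvx | Dist⇒≡dist Dux
  ... | refl | refl | refl | refl | refl | refl =
    ≤-trans (≤-reflexive (+-assoc (dist u v) (dist v w) (dist w x))) (bow-inequality record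
      { v∈I⟨u,w⟩ = v∈I
      ; w∈I⟨v,x⟩ = w∈I
      ; 2≤m      = ≤-trans (s≤s (/-mono-≤ {o = 4} {p = 4} 4≤k ≤-refl)) k/4<m
      ; k≤μ+2m   = k≤k/2+2m k k/4<m })
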